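{- Let $g$ be a (loopless) convex geometry on a finite ground set $I$. The number of enriched convex functions $f: I\rightarrow [\![ n ]\!]$ with respect to $g$ is a polynomial in $n$.
   Context: A convex geometry on $I$ is a closure operator $g:2^I\to 2^I$ with $g(\emptyset)=\emptyset$ satisfying the anti-exchange axiom; subsets $A$ with $g(A)=A$ are called convex. For $n\in\mathbb{N}$, $[\![ n ]\!] = \{\overline{1},1,\overline{2},2,\dots,\overline{n},n\}$ is the set $[n]\sqcup\{\overline{1},\dots,\overline{n}\}$ with the linear order $\overline{1}<1<\overline{2}<2<\dots<\overline{n}<n$, and $[\![ i ]\!]$ denotes its initial segment $\{\overline{1},1,\dots,\overline{i},i\}$. For $A_{i-1}\subseteq A_i$ convex, $g_{A_{i-1}:A_i}$ denotes the minor of $g$ on $A_i\setminus A_{i-1}$ given by $B\mapsto g(B\cup A_{i-1})\cap(A_i\setminus A_{i-1})$; a closure operator is discrete if every set is closed. A function $f:I\to[\![ n ]\!]$ is enriched convex with respect to $g$ if (1) for each convex (i.e. initial) set $A\subseteq[\![ n ]\!]$, $f^{ -1}(A)$ is convex in $g$, and (2) writing $A_i=f^{ -1}([\![ i ]\!])$, the minor $g_{A_{i-1}:A_i}$ restricted to $f^{ -1}(\overline{i})$ is discrete. -}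

module Defs where

open import Data.Nat using (ℕ; zero; suc; _+_; _*_; _<ᵇ_)
open import Data.Bool using (Bool; true; false; if_then_else_)
open import Data.Fin using (Fin; toℕ)
open import Data.Fin.Subset using (Subset; ⊥; ⁅_⁆; _∈_; _∉_; _⊆_; _∩_; _∪_; _─_)
open import Data.Vec using (Vec; lookup; tabulate)
open import Data.List using (List; []; _∷_; length)
open import Data.List.Membership.Propositional using () renaming (_∈_ to _∈ₗ_)
open import Data.List.Relation.Unary.Unique.Propositional using (Unique)
open import Data.Product using (_×_; Σ; ∃)
open import Function.Bundles using (_⇔_)
open import Relation.Binary.PropositionalEquality using (_≡_; _≢_)
open import Relation.Nullary using (¬_)
open import Data.Rational using (ℚ; 0ℚ; _/_) renaming (_+_ to _+ℚ_; _*_ to _*ℚ_)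

record ConvexGeometry (m : ℕ) : Set where
  field
    g          : Subset m → Subset m
    extensive  : ∀ A → A ⊆ g A
    monotone   : ∀ A B → A ⊆ B → g A ⊆ g B
    idempotent : ∀ A → g (g A) ≡ g A
    loopless   : g ⊥ ≡ ⊥
    antiExchange : ∀ A x y → g A ≡ A → x ∉ A → y ∉ A → x ≢ y →
                   y ∈ g (A ∪ ⁅ x ⁆) → x ∉ g (A ∪ ⁅ y ⁆)

-- The chain [[n]] = {1̄ < 1 < 2̄ < 2 < ... < n̄ < n}.
-- An element is (i , b) with i : Fin n; (i , false) stands for the barred
-- element  \overline{i+1}  and (i , true) for  i+1.

⟦_⟧ : ℕ → Set
⟦ n ⟧ = Fin n × Bool

pos : ∀ {n} → ⟦ n ⟧ → ℕ
pos (i Data.Product., b) = 2 * toℕ i + (if b then 1 else 0)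

-- The initial (= convex) subsets of [[n]] are exactly the sets
-- {x | pos x < k} for k = 0, 1, ..., 2n.  The preimage under f of such a set:
preSeg : ∀ {m n} → Vec ⟦ n ⟧ m → ℕ → Subset m
preSeg f k = tabulate (λ x → pos (lookup f x) <ᵇ k)

preBar : ∀ {m n} → Vec ⟦ n ⟧ m → Fin n → Subset m
preBar f i = tabulate (λ x → pos (lookup f x) Data.Nat.≡ᵇ (2 * toℕ i))

minor : ∀ {m} → (Subset m → Subset m) → Subset m → Subset m → Subset m → Subset m
minor g A B C = g (C ∪ A) ∩ (B ─ A)

DiscreteOn : ∀ {m} → (Subset m → Subset m) → Subset m → Set
DiscreteOn h S = ∀ C → C ⊆ S → h C ∩ S ≡ C

record EnrichedConvex {m n} (G : ConvexGeometry m) (f : Vec ⟦ n ⟧ m) : Set where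
  open ConvexGeometry G
  field
    convexPreimages : ∀ k → g (preSeg f k) ≡ preSeg f k
    -- (2) with A_i = f⁻¹([[i]]), the minor g_{A_{i-1}:A_i} restricted to
    --     f⁻¹(\overline{i}) is discrete  (here i is 0-based: A_{i-1} = preSeg f (2i))
    discreteBars : ∀ (i : Fin n) →
      DiscreteOn (minor g (preSeg f (2 * toℕ i)) (preSeg f (2 * toℕ i + 2)))
                 (preBar f i)

NumberOfEnrichedConvex : ∀ {m} → ConvexGeometry m → ℕ → ℕ → Set
NumberOfEnrichedConvex {m} G n c =
  Σ (List (Vec ⟦ n ⟧ m)) λ L →
    Unique L × (∀ f → (f ∈ₗ L) ⇔ EnrichedConvex G f) × length L ≡ c

evalPoly : List ℚ → ℚ → ℚ
evalPoly []       x = 0ℚ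
evalPoly (a ∷ as) x = a +ℚ x *ℚ evalPoly as x

ℕtoℚ : ℕ → ℚ
ℕtoℚ k = Data.Integer.+ k / 1
  where import Data.Integer

-- An enriched convex f : I → [[n]] amounts to the chain of convex sets
-- ∅ = A₀ ⊆ B₁ ⊆ A₁ ⊆ ⋯ ⊆ Bₙ ⊆ Aₙ = I, with Bᵢ = f⁻¹([[i]] ∖ {i}) and Aᵢ = f⁻¹([[i]]), in which
-- every layer (A_{i-1}, Bᵢ, Aᵢ) satisfies the discreteness condition. Generalise from I to
-- an arbitrary convex set D as the last set of the chain and peel off the top layer: the
-- number cₙ(D) of such chains satisfies c_{n+1}(D) = cₙ(D) + Σ cₙ(A), the sum running over
-- the finitely many layers (A, B, D) with A ⊂ D. By well-founded induction on D, n ↦ cₙ(D)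
-- therefore has a Newton series Σₖ aₖ·C(n, k) with natural coefficients, and so is a
-- polynomial in n; the theorem is the case D = I.

module Submission where

open import Defs
open import Data.Nat using (ℕ)
open import Data.List using (List)
open import Data.Product using (Σ; _×_)
open import Data.Rational using (ℚ)
open import Relation.Binary.PropositionalEquality using (_≡_)

open import Data.Nat as ℕ using (zero; suc; _≤_; _<_; _<ᵇ_; _≡ᵇ_; z≤n; s≤s)
import Data.Nat.Properties as ℕ
open import Data.Nat.Tactic.RingSolver using (solve-∀)
open import Data.Nat.ListAction using (sum)
import Data.Nat.Coprimality as Coprimality
open import Data.Integer as ℤ using (+_)
import Data.Integer.Properties as ℤ
open import Data.Rational as ℚ using (mkℚ; 0ℚ; 1ℚ; 1/_; -_; _+_; _*_)
import Data.Rational.Properties as ℚ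
import Data.Rational.Solver as ℚ-Solver
open import Data.Bool using (Bool; true; false; _∨_; if_then_else_)
import Data.Bool.Properties as Bool
open import Data.Fin using (Fin; toℕ; fromℕ; fromℕ<; inject₁)
import Data.Fin.Properties as Fin
open import Data.Fin.Relation.Unary.Top using (view; ‵fromℕ; ‵inj₁; view-fromℕ; view-inject₁)
open import Data.Fin.Subset using (Subset; _⊆_; _⊂_; _∪_; _∩_; _─_; ⊥; ⊤) renaming (_∈_ to _∈ₛ_)
open import Data.Fin.Subset.Properties
  using (_⊆?_; _⊂?_; _∈?_; ⊂-irref; ⊆-antisym; drop-∷-⊆; ∩-zeroʳ; Empty-unique; ∉⊥)
open import Data.Fin.Subset.Induction using (⊂-wellFounded)
open import Data.Vec as Vec using (Vec; []; _∷_; replicate; lookup; _++_)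
import Data.Vec.Properties as Vec
open import Data.List as List
  using ([]; _∷_; map; concatMap; filter; mapMaybe; length; cartesianProduct; cartesianProductWith)
import Data.List.Properties as List
open import Data.List.Membership.Propositional using (_∈_; find; lose)
open import Data.List.Membership.Propositional.Properties
  using ( ∈-map⁺; ∈-map⁻; ∈-concatMap⁺; ∈-concatMap⁻; ∈-filter⁺; ∈-filter⁻
        ; ∈-cartesianProduct⁺; ∈-cartesianProductWith⁺)
open import Data.List.Relation.Unary.Any using (here; there)
open import Data.List.Relation.Unary.All as All using (All; []; _∷_)
open import Data.List.Relation.Unary.Unique.Propositional using (Unique; []; _∷_)
import Data.List.Relation.Unary.Unique.Propositional.Properties as Unique
open import Data.Maybe using (Maybe; just; nothing)
open import Data.Maybe.Effectful using (applicative)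
open import Data.Vec.Effectful using (module TraversableA)
open import Data.Product using (∃; _,_; proj₁; proj₂)
open import Data.Sum using (inj₁; inj₂)
open import Function using (_∘_; id)
open import Function.Bundles using (_⇔_; mk⇔; Equivalence)
open import Induction.WellFounded as WF using (WfRec)
open import Level using (0ℓ)
open import Relation.Binary using (tri<; tri≈; tri>)
open import Relation.Nullary using (¬_; Dec; yes; no; contradiction)
open import Relation.Nullary.Decidable using (_×-dec_; _→-dec_)
open import Relation.Binary.PropositionalEquality
  using (refl; sym; trans; cong; cong₂; subst; _≢_; module ≡-Reasoning)

open TraversableA (applicative {0ℓ}) using (sequenceA)

private variable
  X Y : Set
  x : X
  y : Y
  xs : List X
  m n : ℕ

-- Newton series

binomial : ℕ → ℕ → ℕ
binomial n       zero    = 1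
binomial zero    (suc k) = 0
binomial (suc n) (suc k) = binomial n k ℕ.+ binomial n (suc k)

[1+k]*nC[1+k]+k*nCk≡n*nCk : ∀ n k →
  suc k ℕ.* binomial n (suc k) ℕ.+ k ℕ.* binomial n k ≡ n ℕ.* binomial n k
[1+k]*nC[1+k]+k*nCk≡n*nCk zero    zero    = refl
[1+k]*nC[1+k]+k*nCk≡n*nCk zero    (suc k) = cong₂ ℕ._+_ (ℕ.*-zeroʳ (2 ℕ.+ k)) (ℕ.*-zeroʳ (suc k))
[1+k]*nC[1+k]+k*nCk≡n*nCk (suc n) zero    = cong suc ([1+k]*nC[1+k]+k*nCk≡n*nCk n 0)
[1+k]*nC[1+k]+k*nCk≡n*nCk (suc n) (suc k) = begin
  (2 ℕ.+ k) ℕ.* (b ℕ.+ c) ℕ.+ (1 ℕ.+ k) ℕ.* (a ℕ.+ b)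
    ≡⟨ regroup k a b c ⟩
  ((2 ℕ.+ k) ℕ.* c ℕ.+ (1 ℕ.+ k) ℕ.* b) ℕ.+ ((1 ℕ.+ k) ℕ.* b ℕ.+ k ℕ.* a) ℕ.+ (b ℕ.+ a)
    ≡⟨ cong₂ (λ x y → x ℕ.+ y ℕ.+ (b ℕ.+ a)) ([1+k]*nC[1+k]+k*nCk≡n*nCk n (suc k))
                                              ([1+k]*nC[1+k]+k*nCk≡n*nCk n k) ⟩
  n ℕ.* b ℕ.+ n ℕ.* a ℕ.+ (b ℕ.+ a)
    ≡⟨ collect n a b ⟩
  suc n ℕ.* (a ℕ.+ b) ∎
  where
  open ≡-Reasoning
  a = binomial n k
  b = binomial n (suc k)
  c = binomial n (suc (suc k))
  regroup : ∀ k a b c → (2 ℕ.+ k) ℕ.* (b ℕ.+ c) ℕ.+ (1 ℕ.+ k) ℕ.* (a ℕ.+ b) ≡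
    ((2 ℕ.+ k) ℕ.* c ℕ.+ (1 ℕ.+ k) ℕ.* b) ℕ.+ ((1 ℕ.+ k) ℕ.* b ℕ.+ k ℕ.* a) ℕ.+ (b ℕ.+ a)
  regroup = solve-∀
  collect : ∀ n a b → n ℕ.* b ℕ.+ n ℕ.* a ℕ.+ (b ℕ.+ a) ≡ suc n ℕ.* (a ℕ.+ b)
  collect = solve-∀

-- newton (a₀ ∷ a₁ ∷ ⋯) n = Σᵢ aᵢ · C(n, i) (newton≡binomialSum), computed by Pascal's rule.
newton : List ℕ → ℕ → ℕ
newton []       n       = 0
newton (a ∷ as) zero    = a
newton (a ∷ as) (suc n) = newton (a ∷ as) n ℕ.+ newton as n

binomialSum : List ℕ → ℕ → ℕ → ℕ
binomialSum []       n k = 0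
binomialSum (a ∷ as) n k = a ℕ.* binomial n k ℕ.+ binomialSum as n (suc k)

binomialSum-pascal : ∀ as n k →
  binomialSum as (suc n) (suc k) ≡ binomialSum as n k ℕ.+ binomialSum as n (suc k)
binomialSum-pascal []       n k = refl
binomialSum-pascal (a ∷ as) n k = begin
  a ℕ.* (c ℕ.+ c′) ℕ.+ binomialSum as (suc n) (suc (suc k))
    ≡⟨ cong (a ℕ.* (c ℕ.+ c′) ℕ.+_) (binomialSum-pascal as n (suc k)) ⟩
  a ℕ.* (c ℕ.+ c′) ℕ.+ (s ℕ.+ s′)
    ≡⟨ interchange a c c′ s s′ ⟩
  (a ℕ.* c ℕ.+ s) ℕ.+ (a ℕ.* c′ ℕ.+ s′) ∎
  where
  open ≡-Reasoning
  c  = binomial n k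
  c′ = binomial n (suc k)
  s  = binomialSum as n (suc k)
  s′ = binomialSum as n (suc (suc k))
  interchange : ∀ a x y u v → a ℕ.* (x ℕ.+ y) ℕ.+ (u ℕ.+ v) ≡ (a ℕ.* x ℕ.+ u) ℕ.+ (a ℕ.* y ℕ.+ v)
  interchange = solve-∀

binomialSum-0 : ∀ as k → binomialSum as 0 (suc k) ≡ 0
binomialSum-0 []       k = refl
binomialSum-0 (a ∷ as) k = cong₂ ℕ._+_ (ℕ.*-zeroʳ a) (binomialSum-0 as (suc k))

newton≡binomialSum : ∀ as n → newton as n ≡ binomialSum as n 0
newton≡binomialSum []       n       = refl
newton≡binomialSum (a ∷ as) zero    =
  sym (trans (cong₂ ℕ._+_ (ℕ.*-identityʳ a) (binomialSum-0 as 0)) (ℕ.+-identityʳ a))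
newton≡binomialSum (a ∷ as) (suc n) = begin
  newton (a ∷ as) n ℕ.+ newton as n
    ≡⟨ cong₂ ℕ._+_ (newton≡binomialSum (a ∷ as) n) (newton≡binomialSum as n) ⟩
  (a ℕ.* 1 ℕ.+ u) ℕ.+ v
    ≡⟨ regroup (a ℕ.* 1) u v ⟩
  a ℕ.* 1 ℕ.+ (v ℕ.+ u)
    ≡⟨ cong (a ℕ.* 1 ℕ.+_) (sym (binomialSum-pascal as n 0)) ⟩
  binomialSum (a ∷ as) (suc n) 0 ∎
  where
  open ≡-Reasoning
  u = binomialSum as n 1
  v = binomialSum as n 0
  regroup : ∀ a u v → (a ℕ.+ u) ℕ.+ v ≡ a ℕ.+ (v ℕ.+ u)
  regroup = solve-∀

-- ℕtoℚ normalises, so instance search cannot see that ℕtoℚ (suc k) is nonzero;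
-- natℚ is the same number written directly in lowest terms.
natℚ : ℕ → ℚ
natℚ k = mkℚ (+ k) 0 (Coprimality.sym (Coprimality.1-coprimeTo k))

ℕtoℚ≡natℚ : ∀ k → ℕtoℚ k ≡ natℚ k
ℕtoℚ≡natℚ k = ℚ.normalize-coprime (Coprimality.sym (Coprimality.1-coprimeTo k))

ℕtoℚ-+ : ∀ a b → ℕtoℚ (a ℕ.+ b) ≡ ℕtoℚ a + ℕtoℚ b
ℕtoℚ-+ a b rewrite ℕtoℚ≡natℚ a | ℕtoℚ≡natℚ b =
  cong (ℚ._/ 1) (trans (ℤ.pos-+ a b) (sym (cong₂ ℤ._+_ (ℤ.*-identityʳ (+ a)) (ℤ.*-identityʳ (+ b)))))

ℕtoℚ-* : ∀ a b → ℕtoℚ (a ℕ.* b) ≡ ℕtoℚ a * ℕtoℚ b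
ℕtoℚ-* a b rewrite ℕtoℚ≡natℚ a | ℕtoℚ≡natℚ b = cong (ℚ._/ 1) (ℤ.pos-* a b)

infixl 6 _+ₚ_
infixr 7 _*ₚ_

_+ₚ_ : List ℚ → List ℚ → List ℚ
[]       +ₚ q        = q
(a ∷ p)  +ₚ []       = a ∷ p
(a ∷ p)  +ₚ (b ∷ q)  = (a + b) ∷ (p +ₚ q)

_*ₚ_ : ℚ → List ℚ → List ℚ
c *ₚ []      = []
c *ₚ (a ∷ p) = (c * a) ∷ (c *ₚ p)

evalPoly-+ₚ : ∀ p q x → evalPoly (p +ₚ q) x ≡ evalPoly p x + evalPoly q x
evalPoly-+ₚ []      q       x = sym (ℚ.+-identityˡ _)
evalPoly-+ₚ (a ∷ p) []      x = sym (ℚ.+-identityʳ _)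
evalPoly-+ₚ (a ∷ p) (b ∷ q) x rewrite evalPoly-+ₚ p q x =
  solve 5 (λ a b x u v → (a :+ b) :+ x :* (u :+ v) := (a :+ x :* u) :+ (b :+ x :* v))
        refl a b x (evalPoly p x) (evalPoly q x)
  where open ℚ-Solver.+-*-Solver

evalPoly-*ₚ : ∀ c p x → evalPoly (c *ₚ p) x ≡ c * evalPoly p x
evalPoly-*ₚ c []      x = sym (ℚ.*-zeroʳ c)
evalPoly-*ₚ c (a ∷ p) x rewrite evalPoly-*ₚ c p x =
  solve 4 (λ c a x u → c :* a :+ x :* (c :* u) := c :* (a :+ x :* u)) refl c a x (evalPoly p x)
  where open ℚ-Solver.+-*-Solver

-- C(x, k + 1) = (x − k) · C(x, k) / (k + 1); prepending 0ℚ multiplies by x.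
binomialPoly : ℕ → List ℚ
binomialPoly zero    = 1ℚ ∷ []
binomialPoly (suc k) = 1/ natℚ (suc k) *ₚ (- ℕtoℚ k *ₚ binomialPoly k +ₚ (0ℚ ∷ binomialPoly k))

evalPoly-binomialPoly : ∀ k n → evalPoly (binomialPoly k) (ℕtoℚ n) ≡ ℕtoℚ (binomial n k)
evalPoly-binomialPoly zero    n = solve 1 (λ x → con 1ℚ :+ x :* con 0ℚ := con 1ℚ) refl (ℕtoℚ n)
  where open ℚ-Solver.+-*-Solver
evalPoly-binomialPoly (suc k) n = begin
  evalPoly (binomialPoly (suc k)) N
    ≡⟨ evalPoly-*ₚ r (- K *ₚ binomialPoly k +ₚ (0ℚ ∷ binomialPoly k)) N ⟩
  r * evalPoly (- K *ₚ binomialPoly k +ₚ (0ℚ ∷ binomialPoly k)) N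
    ≡⟨ cong (r *_) (evalPoly-+ₚ (- K *ₚ binomialPoly k) (0ℚ ∷ binomialPoly k) N) ⟩
  r * (evalPoly (- K *ₚ binomialPoly k) N + (0ℚ + N * evalPoly (binomialPoly k) N))
    ≡⟨ cong (λ z → r * (z + (0ℚ + N * evalPoly (binomialPoly k) N)))
            (evalPoly-*ₚ (- K) (binomialPoly k) N) ⟩
  r * (- K * evalPoly (binomialPoly k) N + (0ℚ + N * evalPoly (binomialPoly k) N))
    ≡⟨ cong (λ z → r * (- K * z + (0ℚ + N * z))) (evalPoly-binomialPoly k n) ⟩
  r * (- K * B + (0ℚ + N * B))
    ≡⟨ cong (λ z → r * (- K * B + (0ℚ + z))) (sym absorption) ⟩
  r * (- K * B + (0ℚ + (S * C + K * B)))
    ≡⟨ solve 5 (λ r K B S C → r :* ((:- K) :* B :+ (con 0ℚ :+ (S :* C :+ K :* B))) := (r :* S) :* C)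
             refl r K B S C ⟩
  (r * S) * C
    ≡⟨ cong (_* C) (trans (cong (r *_) (ℕtoℚ≡natℚ (suc k))) (ℚ.*-inverseˡ (natℚ (suc k)))) ⟩
  1ℚ * C
    ≡⟨ ℚ.*-identityˡ C ⟩
  C ∎
  where
  open ≡-Reasoning
  open ℚ-Solver.+-*-Solver
  N = ℕtoℚ n
  K = ℕtoℚ k
  S = ℕtoℚ (suc k)
  r = 1/ natℚ (suc k)
  B = ℕtoℚ (binomial n k)
  C = ℕtoℚ (binomial n (suc k))
  absorption : S * C + K * B ≡ N * B
  absorption = begin
    S * C + K * B
      ≡⟨ cong₂ _+_ (ℕtoℚ-* (suc k) (binomial n (suc k))) (ℕtoℚ-* k (binomial n k)) ⟨
    ℕtoℚ (suc k ℕ.* binomial n (suc k)) + ℕtoℚ (k ℕ.* binomial n k)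
      ≡⟨ ℕtoℚ-+ (suc k ℕ.* binomial n (suc k)) (k ℕ.* binomial n k) ⟨
    ℕtoℚ (suc k ℕ.* binomial n (suc k) ℕ.+ k ℕ.* binomial n k)
      ≡⟨ cong ℕtoℚ ([1+k]*nC[1+k]+k*nCk≡n*nCk n k) ⟩
    ℕtoℚ (n ℕ.* binomial n k)
      ≡⟨ ℕtoℚ-* n (binomial n k) ⟩
    N * B ∎

binomialSumPoly : List ℕ → ℕ → List ℚ
binomialSumPoly []       k = []
binomialSumPoly (a ∷ as) k = ℕtoℚ a *ₚ binomialPoly k +ₚ binomialSumPoly as (suc k)

evalPoly-binomialSumPoly : ∀ as k n →
  evalPoly (binomialSumPoly as k) (ℕtoℚ n) ≡ ℕtoℚ (binomialSum as n k)
evalPoly-binomialSumPoly []       k n = refl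
evalPoly-binomialSumPoly (a ∷ as) k n = begin
  evalPoly (ℕtoℚ a *ₚ binomialPoly k +ₚ binomialSumPoly as (suc k)) N
    ≡⟨ evalPoly-+ₚ (ℕtoℚ a *ₚ binomialPoly k) (binomialSumPoly as (suc k)) N ⟩
  evalPoly (ℕtoℚ a *ₚ binomialPoly k) N + evalPoly (binomialSumPoly as (suc k)) N
    ≡⟨ cong (_+ evalPoly (binomialSumPoly as (suc k)) N) (evalPoly-*ₚ (ℕtoℚ a) (binomialPoly k) N) ⟩
  ℕtoℚ a * evalPoly (binomialPoly k) N + evalPoly (binomialSumPoly as (suc k)) N
    ≡⟨ cong₂ (λ x y → ℕtoℚ a * x + y) (evalPoly-binomialPoly k n) (evalPoly-binomialSumPoly as (suc k) n) ⟩
  ℕtoℚ a * ℕtoℚ (binomial n k) + ℕtoℚ (binomialSum as n (suc k))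
    ≡⟨ cong (_+ ℕtoℚ (binomialSum as n (suc k))) (ℕtoℚ-* a (binomial n k)) ⟨
  ℕtoℚ (a ℕ.* binomial n k) + ℕtoℚ (binomialSum as n (suc k))
    ≡⟨ ℕtoℚ-+ (a ℕ.* binomial n k) (binomialSum as n (suc k)) ⟨
  ℕtoℚ (binomialSum (a ∷ as) n k) ∎
  where
  open ≡-Reasoning
  N = ℕtoℚ n

HasNewtonForm : (ℕ → ℕ) → Set
HasNewtonForm f = Σ (List ℕ) λ as → ∀ n → newton as n ≡ f n

newtonForm⇒polynomial : ∀ {f} → HasNewtonForm f → Σ (List ℚ) λ p → ∀ n → evalPoly p (ℕtoℚ n) ≡ ℕtoℚ (f n)
newtonForm⇒polynomial (as , newton≡f) =
  binomialSumPoly as 0 , λ n → trans (evalPoly-binomialSumPoly as 0 n)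
                                     (cong ℕtoℚ (trans (sym (newton≡binomialSum as n)) (newton≡f n)))

newtonForm-resp : ∀ {f h} → (∀ n → f n ≡ h n) → HasNewtonForm f → HasNewtonForm h
newtonForm-resp f≗h (as , newton≡f) = as , λ n → trans (newton≡f n) (f≗h n)

newtonForm-step : ∀ {f r} → HasNewtonForm r → (∀ n → f (suc n) ≡ f n ℕ.+ r n) → HasNewtonForm f
newtonForm-step {f} (as , newton≡r) step = f 0 ∷ as , newton≡f
  where
  newton≡f : ∀ n → newton (f 0 ∷ as) n ≡ f n
  newton≡f zero    = refl
  newton≡f (suc n) = trans (cong₂ ℕ._+_ (newton≡f n) (newton≡r n)) (sym (step n))

_+ₙ_ : List ℕ → List ℕ → List ℕ
[]       +ₙ bs       = bs
(a ∷ as) +ₙ []       = a ∷ as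
(a ∷ as) +ₙ (b ∷ bs) = (a ℕ.+ b) ∷ (as +ₙ bs)

newton-+ₙ : ∀ as bs n → newton (as +ₙ bs) n ≡ newton as n ℕ.+ newton bs n
newton-+ₙ []       bs       n       = refl
newton-+ₙ (a ∷ as) []       n       = sym (ℕ.+-identityʳ _)
newton-+ₙ (a ∷ as) (b ∷ bs) zero    = refl
newton-+ₙ (a ∷ as) (b ∷ bs) (suc n) = begin
  newton ((a ∷ as) +ₙ (b ∷ bs)) n ℕ.+ newton (as +ₙ bs) n
    ≡⟨ cong₂ ℕ._+_ (newton-+ₙ (a ∷ as) (b ∷ bs) n) (newton-+ₙ as bs n) ⟩
  (newton (a ∷ as) n ℕ.+ newton (b ∷ bs) n) ℕ.+ (newton as n ℕ.+ newton bs n)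
    ≡⟨ interchange (newton (a ∷ as) n) (newton (b ∷ bs) n) (newton as n) (newton bs n) ⟩
  (newton (a ∷ as) n ℕ.+ newton as n) ℕ.+ (newton (b ∷ bs) n ℕ.+ newton bs n) ∎
  where
  open ≡-Reasoning
  interchange : ∀ x y u v → (x ℕ.+ y) ℕ.+ (u ℕ.+ v) ≡ (x ℕ.+ u) ℕ.+ (y ℕ.+ v)
  interchange = solve-∀

newtonForm-sum : ∀ {X : Set} (xs : List X) (h : X → ℕ → ℕ) →
  (∀ {x} → x ∈ xs → HasNewtonForm (h x)) → HasNewtonForm (λ n → sum (map (λ x → h x n) xs))
newtonForm-sum []       h _   = [] , λ _ → refl
newtonForm-sum (x ∷ xs) h hxs with hxs (here refl) | newtonForm-sum xs h (hxs ∘ there)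
... | as , newton≡hx | bs , newton≡rest =
  as +ₙ bs , λ n → trans (newton-+ₙ as bs n) (cong₂ ℕ._+_ (newton≡hx n) (newton≡rest n))

length-concatMap : (f : X → List Y) (xs : List X) →
  length (concatMap f xs) ≡ sum (map (length ∘ f) xs)
length-concatMap f []       = refl
length-concatMap f (x ∷ xs) =
  trans (List.length-++ (f x)) (cong (length (f x) ℕ.+_) (length-concatMap f xs))

concatMap-unique : (f : X → List Y) (σ : Y → X) → Unique xs → (∀ x → Unique (f x)) →
  (∀ {x y} → x ∈ xs → y ∈ f x → σ y ≡ x) → Unique (concatMap f xs)
concatMap-unique f σ []            _   _ = []
concatMap-unique {xs = x ∷ xs} f σ (x∉xs ∷ !xs) !f sig =
  Unique.++⁺ (!f _) (concatMap-unique f σ !xs !f (sig ∘ there)) disjoint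
  where
  disjoint : ∀ {y} → ¬ (y ∈ f x × y ∈ concatMap f xs)
  disjoint (y∈fx , y∈rest) with find (∈-concatMap⁻ f y∈rest)
  ... | x′ , x′∈xs , y∈fx′ =
    All.lookup x∉xs x′∈xs (trans (sym (sig (here refl) y∈fx)) (sig (there x′∈xs) y∈fx′))

module _ (f : X → Maybe Y) where

  ∈-mapMaybe⁺ : x ∈ xs → f x ≡ just y → y ∈ mapMaybe f xs
  ∈-mapMaybe⁺ {xs = x ∷ xs} (here refl) fx≡y rewrite fx≡y = here refl
  ∈-mapMaybe⁺ {xs = x ∷ xs} (there x∈xs) fx≡y with f x
  ... | just _  = there (∈-mapMaybe⁺ x∈xs fx≡y)
  ... | nothing = ∈-mapMaybe⁺ x∈xs fx≡y

  ∈-mapMaybe⁻ : ∀ xs → y ∈ mapMaybe f xs → ∃ λ x → x ∈ xs × f x ≡ just y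
  ∈-mapMaybe⁻ (x ∷ xs) y∈ with f x in fx≡
  ∈-mapMaybe⁻ (x ∷ xs) (here refl) | just _ = x , here refl , fx≡
  ∈-mapMaybe⁻ (x ∷ xs) (there y∈) | just _ with ∈-mapMaybe⁻ xs y∈
  ... | x′ , x′∈ , fx′≡ = x′ , there x′∈ , fx′≡
  ∈-mapMaybe⁻ (x ∷ xs) y∈ | nothing with ∈-mapMaybe⁻ xs y∈
  ... | x′ , x′∈ , fx′≡ = x′ , there x′∈ , fx′≡

  mapMaybe-unique : (∀ {x x′ y} → f x ≡ just y → f x′ ≡ just y → x ≡ x′) →
    Unique xs → Unique (mapMaybe f xs)
  mapMaybe-unique {xs = []}     f-inj []            = []
  mapMaybe-unique {xs = x ∷ xs} f-inj (x∉xs ∷ !xs) with f x in fx≡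
  ... | nothing = mapMaybe-unique f-inj !xs
  ... | just y  = All.tabulate fresh ∷ mapMaybe-unique f-inj !xs
    where
    fresh : ∀ {y′} → y′ ∈ mapMaybe f xs → y ≢ y′
    fresh y′∈ refl with ∈-mapMaybe⁻ xs y′∈
    ... | x′ , x′∈xs , fx′≡ = All.lookup x∉xs x′∈xs (f-inj fx≡ fx′≡)

  length-mapMaybe-total : All (λ x → ∃ λ y → f x ≡ just y) xs → length (mapMaybe f xs) ≡ length xs
  length-mapMaybe-total {xs = []}     []                    = refl
  length-mapMaybe-total {xs = x ∷ xs} ((y , fx≡y) ∷ total) rewrite fx≡y =
    cong suc (length-mapMaybe-total total)

subsets : ∀ k → List (Subset k)
subsets zero    = [] ∷ []
subsets (suc k) = cartesianProductWith _∷_ (true ∷ false ∷ []) (subsets k)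

∈-subsets : ∀ {k} (p : Subset k) → p ∈ subsets k
∈-subsets []          = here refl
∈-subsets (true ∷ p)  = ∈-cartesianProductWith⁺ _∷_ {xs = true ∷ false ∷ []} (here refl) (∈-subsets p)
∈-subsets (false ∷ p) =
  ∈-cartesianProductWith⁺ _∷_ {xs = true ∷ false ∷ []} (there (here refl)) (∈-subsets p)

subsets-unique : ∀ k → Unique (subsets k)
subsets-unique zero    = [] ∷ []
subsets-unique (suc k) =
  Unique.cartesianProductWith⁺ _∷_ Vec.∷-injective (((λ ()) ∷ []) ∷ [] ∷ []) (subsets-unique k)

p⊆q⇒p∪q≡q : ∀ {p q : Subset m} → p ⊆ q → p ∪ q ≡ q
p⊆q⇒p∪q≡q {p = []}        {[]}        _   = refl
p⊆q⇒p∪q≡q {p = true ∷ p}  {true ∷ q}  p⊆q = cong (true ∷_) (p⊆q⇒p∪q≡q (drop-∷-⊆ p⊆q))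
p⊆q⇒p∪q≡q {p = true ∷ p}  {false ∷ q} p⊆q with () ← p⊆q Vec.here
p⊆q⇒p∪q≡q {p = false ∷ p} {b ∷ q}     p⊆q = cong (b ∷_) (p⊆q⇒p∪q≡q (drop-∷-⊆ p⊆q))

p─p≡⊥ : ∀ (p : Subset m) → p ─ p ≡ ⊥
p─p≡⊥ []          = refl
p─p≡⊥ (true ∷ p)  = cong (false ∷_) (p─p≡⊥ p)
p─p≡⊥ (false ∷ p) = cong (false ∷_) (p─p≡⊥ p)

⊆∧⊄⇒≡ : ∀ {p q : Subset m} → p ⊆ q → ¬ p ⊂ q → p ≡ q
⊆∧⊄⇒≡ {p = p} {q} p⊆q p⊄q = ⊆-antisym p⊆q q⊆p
  where
  q⊆p : q ⊆ p
  q⊆p {x} x∈q with x ∈? p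
  ... | yes x∈p = x∈p
  ... | no  x∉p = contradiction ((λ {y} → p⊆q {y}) , x , x∈q , x∉p) p⊄q

<ᵇ-true : ∀ {i j} → i < j → (i <ᵇ j) ≡ true
<ᵇ-true i<j = Equivalence.to Bool.T-≡ (ℕ.<⇒<ᵇ i<j)

<ᵇ-false : ∀ {i j} → j ≤ i → (i <ᵇ j) ≡ false
<ᵇ-false {i} {j} j≤i = Bool.¬-not (λ i<ᵇj → ℕ.≤⇒≯ j≤i (ℕ.<ᵇ⇒< i j (Equivalence.from Bool.T-≡ i<ᵇj)))

2t+2≤2n : ∀ {t n} → t < n → 2 ℕ.* t ℕ.+ 2 ≤ 2 ℕ.* n
2t+2≤2n {t} t<n =
  ℕ.≤-trans (ℕ.≤-reflexive (trans (ℕ.+-comm _ 2) (sym (ℕ.*-suc 2 t)))) (ℕ.*-monoʳ-≤ 2 t<n)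

pos<2n : (a : ⟦ n ⟧) → pos a < 2 ℕ.* n
pos<2n {n} (i , b) = begin-strict
  2 ℕ.* toℕ i ℕ.+ (if b then 1 else 0) ≤⟨ ℕ.+-monoʳ-≤ (2 ℕ.* toℕ i) (bit≤1 b) ⟩
  2 ℕ.* toℕ i ℕ.+ 1                     <⟨ ℕ.+-monoʳ-< (2 ℕ.* toℕ i) (ℕ.n<1+n 1) ⟩
  2 ℕ.* toℕ i ℕ.+ 2                     ≡⟨ ℕ.+-comm (2 ℕ.* toℕ i) 2 ⟩
  2 ℕ.+ 2 ℕ.* toℕ i                     ≡⟨ ℕ.*-suc 2 (toℕ i) ⟨
  2 ℕ.* suc (toℕ i)                     ≤⟨ ℕ.*-monoʳ-≤ 2 (Fin.toℕ<n i) ⟩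
  2 ℕ.* n                               ∎
  where
  open ℕ.≤-Reasoning
  bit≤1 : ∀ b → (if b then 1 else 0) ≤ 1
  bit≤1 true  = s≤s z≤n
  bit≤1 false = z≤n

pos-inject₁ : ∀ (i : Fin n) b → pos (inject₁ i , b) ≡ pos (i , b)
pos-inject₁ i b = cong (λ t → 2 ℕ.* t ℕ.+ (if b then 1 else 0)) (Fin.toℕ-inject₁ i)

pos-fromℕ-false : ∀ n → pos (fromℕ n , false) ≡ 2 ℕ.* n
pos-fromℕ-false n = trans (ℕ.+-identityʳ _) (cong (2 ℕ.*_) (Fin.toℕ-fromℕ n))

pos-fromℕ-true : ∀ n → pos (fromℕ n , true) ≡ suc (2 ℕ.* n)
pos-fromℕ-true n = trans (ℕ.+-comm _ 1) (cong (λ t → suc (2 ℕ.* t)) (Fin.toℕ-fromℕ n))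

-- Partial functions I ⇀ [[n]]

below : Maybe ⟦ n ⟧ → ℕ → Bool
below nothing  k = false
below (just a) k = pos a <ᵇ k

below-2n : (a : ⟦ n ⟧) → below (just a) (2 ℕ.* n) ≡ true
below-2n a = <ᵇ-true (pos<2n a)

below-suc : ∀ (v : Maybe ⟦ n ⟧) {k} → below v k ≡ true → below v (suc k) ≡ true
below-suc (just a) {k} e = <ᵇ-true (ℕ.m<n⇒m<1+n (ℕ.<ᵇ⇒< (pos a) k (Equivalence.from Bool.T-≡ e)))

-- A new top level: undefined points go to the new n̄ if they are in the first set and to the
-- new n if they are only in the second.
extendValue : Bool → Bool → Maybe ⟦ n ⟧ → Maybe ⟦ suc n ⟧
extendValue     _     _     (just (i , b)) = just (inject₁ i , b)
extendValue {n} true  _     nothing        = just (fromℕ n , false)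
extendValue {n} false true  nothing        = just (fromℕ n , true)
extendValue     false false nothing        = nothing

restrictValue : Maybe ⟦ suc n ⟧ → Maybe ⟦ n ⟧
restrictValue nothing = nothing
restrictValue (just (i , b)) with view i
... | ‵fromℕ     = nothing
... | ‵inj₁ {i = j} _ = just (j , b)

restrictValue-inject₁ : ∀ (i : Fin n) b → restrictValue (just (inject₁ i , b)) ≡ just (i , b)
restrictValue-inject₁ i b rewrite view-inject₁ i = refl

restrictValue-fromℕ : ∀ n b → restrictValue (just (fromℕ n , b)) ≡ nothing
restrictValue-fromℕ n b rewrite view-fromℕ n = refl

module _ {n k : ℕ} where

  below-extendValue-≤ : ∀ b d (v : Maybe ⟦ n ⟧) → k ≤ 2 ℕ.* n →
    below (extendValue b d v) k ≡ below v k
  below-extendValue-≤ _     _     (just (i , b)) _  = cong (_<ᵇ k) (pos-inject₁ i b)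
  below-extendValue-≤ true  _     nothing        k≤ rewrite pos-fromℕ-false n = <ᵇ-false k≤
  below-extendValue-≤ false true  nothing        k≤ rewrite pos-fromℕ-true n = <ᵇ-false (ℕ.m≤n⇒m≤1+n k≤)
  below-extendValue-≤ false false nothing        _  = refl

  below-extendValue-top : ∀ b d (v : Maybe ⟦ n ⟧) → 2 ℕ.+ 2 ℕ.* n ≤ k →
    below (extendValue b d v) k ≡ below v (2 ℕ.* n) ∨ (b ∨ d)
  below-extendValue-top _     _     (just (i , b)) k≥ rewrite pos-inject₁ i b | below-2n (i , b) =
    <ᵇ-true (ℕ.<-≤-trans (pos<2n (i , b)) (ℕ.≤-trans (ℕ.m≤n+m _ 2) k≥))
  below-extendValue-top true  _     nothing        k≥ rewrite pos-fromℕ-false n =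
    <ᵇ-true (ℕ.≤-trans (ℕ.n≤1+n _) k≥)
  below-extendValue-top false true  nothing        k≥ rewrite pos-fromℕ-true n = <ᵇ-true k≥
  below-extendValue-top false false nothing        _  = refl

below-extendValue-bar : ∀ b d (v : Maybe ⟦ n ⟧) →
  below (extendValue b d v) (suc (2 ℕ.* n)) ≡ below v (2 ℕ.* n) ∨ b
below-extendValue-bar     _     _     (just (i , b)) rewrite pos-inject₁ i b | below-2n (i , b) =
  <ᵇ-true (ℕ.m<n⇒m<1+n (pos<2n (i , b)))
below-extendValue-bar {n} true  _     nothing rewrite pos-fromℕ-false n = <ᵇ-true (ℕ.n<1+n (2 ℕ.* n))
below-extendValue-bar {n} false true  nothing rewrite pos-fromℕ-true n = <ᵇ-false (ℕ.≤-refl {suc (2 ℕ.* n)})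
below-extendValue-bar     false false nothing = refl

below-fromℕ-false : ∀ n k → below (just (fromℕ n , false)) k ≡ (2 ℕ.* n <ᵇ k)
below-fromℕ-false n k = cong (_<ᵇ k) (pos-fromℕ-false n)

below-fromℕ-true : ∀ n k → below (just (fromℕ n , true)) k ≡ (suc (2 ℕ.* n) <ᵇ k)
below-fromℕ-true n k = cong (_<ᵇ k) (pos-fromℕ-true n)

below-restrictValue-≤ : ∀ (v : Maybe ⟦ suc n ⟧) {k} → k ≤ 2 ℕ.* n → below (restrictValue v) k ≡ below v k
below-restrictValue-≤ nothing        _ = refl
below-restrictValue-≤ (just (i , b)) {k} k≤ with view i
below-restrictValue-≤ (just (_ , false)) {k} k≤ | ‵fromℕ {n} =
  sym (trans (below-fromℕ-false n k) (<ᵇ-false k≤))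
below-restrictValue-≤ (just (_ , true))  {k} k≤ | ‵fromℕ {n} =
  sym (trans (below-fromℕ-true n k) (<ᵇ-false (ℕ.m≤n⇒m≤1+n k≤)))
below-restrictValue-≤ (just (_ , b))     {k} k≤ | ‵inj₁ {i = j} _ = cong (_<ᵇ k) (sym (pos-inject₁ j b))

extendValue-restrictValue : ∀ (v : Maybe ⟦ suc n ⟧) →
  extendValue (below v (suc (2 ℕ.* n))) (below v (2 ℕ.+ 2 ℕ.* n)) (restrictValue v) ≡ v
extendValue-restrictValue nothing = refl
extendValue-restrictValue (just (i , b)) with view i
extendValue-restrictValue (just (_ , false)) | ‵fromℕ {n} =
  cong (λ c → extendValue c (below (just (fromℕ n , false)) (2 ℕ.+ 2 ℕ.* n)) nothing)
    (trans (below-fromℕ-false n (suc (2 ℕ.* n))) (<ᵇ-true (ℕ.n<1+n (2 ℕ.* n))))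
extendValue-restrictValue (just (_ , true))  | ‵fromℕ {n} =
  cong₂ (λ c d → extendValue c d nothing)
    (trans (below-fromℕ-true n (suc (2 ℕ.* n))) (<ᵇ-false (ℕ.≤-refl {suc (2 ℕ.* n)})))
    (trans (below-fromℕ-true n (2 ℕ.+ 2 ℕ.* n)) (<ᵇ-true (ℕ.≤-refl {2 ℕ.+ 2 ℕ.* n})))
extendValue-restrictValue (just (_ , b))     | ‵inj₁ _ = refl

restrictValue-extendValue : ∀ b d (v : Maybe ⟦ n ⟧) → restrictValue (extendValue b d v) ≡ v
restrictValue-extendValue     _     _     (just (i , b)) = restrictValue-inject₁ i b
restrictValue-extendValue {n} true  _     nothing        = restrictValue-fromℕ n false
restrictValue-extendValue {n} false true  nothing        = restrictValue-fromℕ n true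
restrictValue-extendValue     false false nothing        = refl

segment : Vec (Maybe ⟦ n ⟧) m → ℕ → Subset m
segment F k = Vec.map (λ v → below v k) F

extend : Subset m → Subset m → Vec (Maybe ⟦ n ⟧) m → Vec (Maybe ⟦ suc n ⟧) m
extend []      []      []      = []
extend (b ∷ B) (d ∷ D) (v ∷ F) = extendValue b d v ∷ extend B D F

restrict : Vec (Maybe ⟦ suc n ⟧) m → Vec (Maybe ⟦ n ⟧) m
restrict = Vec.map restrictValue

module _ {n k : ℕ} where

  segment-extend-≤ : ∀ (B D : Subset m) (F : Vec (Maybe ⟦ n ⟧) m) → k ≤ 2 ℕ.* n →
    segment (extend B D F) k ≡ segment F k
  segment-extend-≤ []      []      []      _  = refl
  segment-extend-≤ (b ∷ B) (d ∷ D) (v ∷ F) k≤ =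
    cong₂ _∷_ (below-extendValue-≤ b d v k≤) (segment-extend-≤ B D F k≤)

  segment-extend-top : ∀ (B D : Subset m) (F : Vec (Maybe ⟦ n ⟧) m) → 2 ℕ.+ 2 ℕ.* n ≤ k →
    segment (extend B D F) k ≡ segment F (2 ℕ.* n) ∪ (B ∪ D)
  segment-extend-top []      []      []      _  = refl
  segment-extend-top (b ∷ B) (d ∷ D) (v ∷ F) k≥ =
    cong₂ _∷_ (below-extendValue-top b d v k≥) (segment-extend-top B D F k≥)

  segment-restrict-≤ : ∀ (F : Vec (Maybe ⟦ suc n ⟧) m) → k ≤ 2 ℕ.* n →
    segment (restrict F) k ≡ segment F k
  segment-restrict-≤ []      _  = refl
  segment-restrict-≤ (v ∷ F) k≤ = cong₂ _∷_ (below-restrictValue-≤ v k≤) (segment-restrict-≤ F k≤)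

segment-extend-bar : ∀ (B D : Subset m) (F : Vec (Maybe ⟦ n ⟧) m) →
  segment (extend B D F) (suc (2 ℕ.* n)) ≡ segment F (2 ℕ.* n) ∪ B
segment-extend-bar []      []      []      = refl
segment-extend-bar (b ∷ B) (d ∷ D) (v ∷ F) =
  cong₂ _∷_ (below-extendValue-bar b d v) (segment-extend-bar B D F)

extend-restrict : ∀ (F : Vec (Maybe ⟦ suc n ⟧) m) →
  extend (segment F (suc (2 ℕ.* n))) (segment F (2 ℕ.+ 2 ℕ.* n)) (restrict F) ≡ F
extend-restrict []      = refl
extend-restrict (v ∷ F) = cong₂ _∷_ (extendValue-restrictValue v) (extend-restrict F)

restrict-extend : ∀ (B D : Subset m) (F : Vec (Maybe ⟦ n ⟧) m) → restrict (extend B D F) ≡ F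
restrict-extend []      []      []      = refl
restrict-extend (b ∷ B) (d ∷ D) (v ∷ F) =
  cong₂ _∷_ (restrictValue-extendValue b d v) (restrict-extend B D F)

segment-⊆-suc : ∀ (F : Vec (Maybe ⟦ n ⟧) m) k → segment F k ⊆ segment F (suc k)
segment-⊆-suc F k {x} x∈ = Vec.lookup⇒[]= x (segment F (suc k))
  (trans (Vec.lookup-map x _ F)
         (below-suc (lookup F x) (trans (sym (Vec.lookup-map x _ F)) (Vec.[]=⇒lookup x∈))))

segment-≥ : ∀ (F : Vec (Maybe ⟦ n ⟧) m) {k} → 2 ℕ.* n ≤ k → segment F k ≡ segment F (2 ℕ.* n)
segment-≥ []                  _  = refl
segment-≥ (nothing ∷ F)       k≥ = cong (false ∷_) (segment-≥ F k≥)
segment-≥ (just a ∷ F) {k}    k≥ =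
  cong₂ _∷_ (trans (<ᵇ-true (ℕ.<-≤-trans (pos<2n a) k≥)) (sym (below-2n a))) (segment-≥ F k≥)

module _ {A B D : Subset m} {F : Vec (Maybe ⟦ n ⟧) m}
         (A⊆B : A ⊆ B) (F-domain : segment F (2 ℕ.* n) ≡ A) where

  segment-extend-bar≡ : segment (extend B D F) (suc (2 ℕ.* n)) ≡ B
  segment-extend-bar≡ = trans (segment-extend-bar B D F) (trans (cong (_∪ B) F-domain) (p⊆q⇒p∪q≡q A⊆B))

  segment-extend-top≡ : B ⊆ D → ∀ {k} → 2 ℕ.+ 2 ℕ.* n ≤ k → segment (extend B D F) k ≡ D
  segment-extend-top≡ B⊆D k≥ = trans (segment-extend-top B D F k≥)
    (trans (cong (_∪ (B ∪ D)) F-domain) (trans (cong (A ∪_) (p⊆q⇒p∪q≡q B⊆D)) (p⊆q⇒p∪q≡q (B⊆D ∘ A⊆B))))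

nowhere-unique : ∀ (F : Vec (Maybe ⟦ 0 ⟧) m) → F ≡ replicate m nothing
nowhere-unique []            = refl
nowhere-unique (nothing ∷ F) = cong (nothing ∷_) (nowhere-unique F)

segment-nowhere : ∀ m k → segment (replicate {A = Maybe ⟦ n ⟧} m nothing) k ≡ ⊥
segment-nowhere zero    k = refl
segment-nowhere (suc m) k = cong (false ∷_) (segment-nowhere m k)

segment-map-just : ∀ (f : Vec ⟦ n ⟧ m) k → segment (Vec.map just f) k ≡ preSeg f k
segment-map-just []      k = refl
segment-map-just (a ∷ f) k = cong (_ ∷_) (segment-map-just f k)

segment-map-just-2n : ∀ (f : Vec ⟦ n ⟧ m) → segment (Vec.map just f) (2 ℕ.* n) ≡ ⊤
segment-map-just-2n []      = refl
segment-map-just-2n (a ∷ f) = cong₂ _∷_ (below-2n a) (segment-map-just-2n f)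

preBar≡preSeg─preSeg : ∀ (f : Vec ⟦ n ⟧ m) i →
  preBar f i ≡ preSeg f (suc (2 ℕ.* toℕ i)) ─ preSeg f (2 ℕ.* toℕ i)
preBar≡preSeg─preSeg []      i = refl
preBar≡preSeg─preSeg (a ∷ f) i = cong₂ _++_ (≡ᵇ≡<ᵇ-suc─<ᵇ (pos a) (2 ℕ.* toℕ i)) (preBar≡preSeg─preSeg f i)
  where
  ≡ᵇ≡<ᵇ-suc─<ᵇ : ∀ p t → (p ≡ᵇ t) ∷ [] ≡ ((p <ᵇ suc t) ∷ []) ─ ((p <ᵇ t) ∷ [])
  ≡ᵇ≡<ᵇ-suc─<ᵇ zero    zero    = refl
  ≡ᵇ≡<ᵇ-suc─<ᵇ zero    (suc t) = refl
  ≡ᵇ≡<ᵇ-suc─<ᵇ (suc p) zero    = refl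
  ≡ᵇ≡<ᵇ-suc─<ᵇ (suc p) (suc t) = ≡ᵇ≡<ᵇ-suc─<ᵇ p t

sequenceA-map-just : ∀ {A : Set} (f : Vec A m) → sequenceA (Vec.map just f) ≡ just f
sequenceA-map-just []      = refl
sequenceA-map-just (a ∷ f) rewrite sequenceA-map-just f = refl

sequenceA≡just : ∀ {A : Set} (F : Vec (Maybe A) m) {f} → sequenceA F ≡ just f → F ≡ Vec.map just f
sequenceA≡just []            refl = refl
sequenceA≡just (just a ∷ F)  e    with sequenceA F in eq
sequenceA≡just (just a ∷ F) refl | just f = cong (just a ∷_) (sequenceA≡just F eq)

segment≡⊤⇒sequenceA-just : ∀ (F : Vec (Maybe ⟦ n ⟧) m) {k} → segment F k ≡ ⊤ → ∃ λ f → sequenceA F ≡ just f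
segment≡⊤⇒sequenceA-just []                        _ = [] , refl
segment≡⊤⇒sequenceA-just (nothing ∷ F)             e with () ← proj₁ (Vec.∷-injective e)
segment≡⊤⇒sequenceA-just (just a ∷ F) e with segment≡⊤⇒sequenceA-just F (proj₂ (Vec.∷-injective e))
... | f , eq rewrite eq = a ∷ f , refl

-- Counting enriched convex functions

module Enumeration {m : ℕ} (G : ConvexGeometry m) where

  open ConvexGeometry G

  IsConvex : Subset m → Set
  IsConvex A = g A ≡ A

  -- Condition (2) at level i: f⁻¹(ī) = B ∖ A is discrete in the minor g_{A:D}, where
  -- A = A_{i-1}, B = f⁻¹([[i]] ∖ {i}) and D = A_i.
  DiscreteLayer : Subset m → Subset m → Subset m → Set
  DiscreteLayer A B D = DiscreteOn (minor g A D) (B ─ A)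

  DiscreteLayer-cong : ∀ {A A′ B B′ D D′} → A ≡ A′ → B ≡ B′ → D ≡ D′ →
    DiscreteLayer A B D → DiscreteLayer A′ B′ D′
  DiscreteLayer-cong refl refl refl = id

  Layer : Subset m → Subset m → Subset m → Set
  Layer A B D = A ⊆ B × B ⊆ D × IsConvex B × IsConvex D × DiscreteLayer A B D

  Layer-refl : ∀ {D} → IsConvex D → Layer D D D
  Layer-refl {D} D-convex = id , id , D-convex , D-convex , discrete
    where
    discrete : DiscreteLayer D D D
    discrete C C⊆D─D = begin
      minor g D D C ∩ (D ─ D) ≡⟨ cong (minor g D D C ∩_) (p─p≡⊥ D) ⟩
      minor g D D C ∩ ⊥       ≡⟨ ∩-zeroʳ _ ⟩
      ⊥                       ≡⟨ Empty-unique (λ (x , x∈C) → ∉⊥ (subst (x ∈ₛ_) (p─p≡⊥ D) (C⊆D─D x∈C))) ⟨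
      C                       ∎
      where open ≡-Reasoning

  DiscreteLayerAt : ∀ {n} → Vec (Maybe ⟦ n ⟧) m → ℕ → Set
  DiscreteLayerAt F t =
    DiscreteLayer (segment F (2 ℕ.* t)) (segment F (suc (2 ℕ.* t))) (segment F (2 ℕ.* t ℕ.+ 2))

  DiscreteLayerAt-transfer : ∀ {n n′ t N} {F : Vec (Maybe ⟦ n ⟧) m} {F′ : Vec (Maybe ⟦ n′ ⟧) m} → t < N →
    (∀ {k} → k ≤ 2 ℕ.* N → segment F k ≡ segment F′ k) → DiscreteLayerAt F t → DiscreteLayerAt F′ t
  DiscreteLayerAt-transfer t<N agree = DiscreteLayer-cong (agree (ℕ.≤-trans (ℕ.m≤m+n _ 2) (2t+2≤2n t<N)))
    (agree (ℕ.≤-trans (ℕ.m<m+n _ ℕ.z<s) (2t+2≤2n t<N))) (agree (2t+2≤2n t<N))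

  -- A partial function F : D → [[n]], undefined outside D, satisfying the conditions of
  -- EnrichedConvex with segment F k in place of preSeg f k.
  record EnrichedConvexOn (n : ℕ) (D : Subset m) (F : Vec (Maybe ⟦ n ⟧) m) : Set where
    field
      domain         : segment F (2 ℕ.* n) ≡ D
      convexSegments : ∀ k → IsConvex (segment F k)
      discreteLayers : ∀ t → t < n → DiscreteLayerAt F t
  open EnrichedConvexOn

  domain-convex : ∀ {n D F} → EnrichedConvexOn n D F → IsConvex D
  domain-convex {n} E = subst IsConvex (domain E) (convexSegments E (2 ℕ.* n))

  extend-enrichedOn : ∀ {n A B D} {F : Vec (Maybe ⟦ n ⟧) m} →
    Layer A B D → EnrichedConvexOn n A F → EnrichedConvexOn (suc n) D (extend B D F)
  extend-enrichedOn {n} {A} {B} {D} {F} (A⊆B , B⊆D , B-convex , D-convex , B─A-discrete) E = record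
    { domain         = at-top (ℕ.≤-reflexive (sym (ℕ.*-suc 2 n)))
    ; convexSegments = convex
    ; discreteLayers = discrete
    }
    where
    at-bar : segment (extend B D F) (suc (2 ℕ.* n)) ≡ B
    at-bar = segment-extend-bar≡ A⊆B (domain E)
    at-top : ∀ {k} → 2 ℕ.+ 2 ℕ.* n ≤ k → segment (extend B D F) k ≡ D
    at-top = segment-extend-top≡ A⊆B (domain E) B⊆D
    convex : ∀ k → IsConvex (segment (extend B D F) k)
    convex k with ℕ.<-cmp k (suc (2 ℕ.* n))
    ... | tri< k<  _ _ = subst IsConvex (sym (segment-extend-≤ B D F (ℕ.m<1+n⇒m≤n k<))) (convexSegments E k)
    ... | tri≈ _ refl _ = subst IsConvex (sym at-bar) B-convex
    ... | tri> _ _ k>  = subst IsConvex (sym (at-top k>)) D-convex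
    discrete : ∀ t → t < suc n → DiscreteLayerAt (extend B D F) t
    discrete t t<1+n with ℕ.m<1+n⇒m<n∨m≡n t<1+n
    ... | inj₁ t<n =
      DiscreteLayerAt-transfer t<n (λ k≤ → sym (segment-extend-≤ B D F k≤)) (discreteLayers E t t<n)
    ... | inj₂ refl = DiscreteLayer-cong (sym (trans (segment-extend-≤ B D F ℕ.≤-refl) (domain E)))
                        (sym at-bar) (sym (at-top (ℕ.≤-reflexive (ℕ.+-comm 2 _)))) B─A-discrete

  module _ {n D} {F : Vec (Maybe ⟦ suc n ⟧) m} (E : EnrichedConvexOn (suc n) D F) where

    private
      segment-2+2n : segment F (2 ℕ.+ 2 ℕ.* n) ≡ D
      segment-2+2n = trans (cong (segment F) (sym (ℕ.*-suc 2 n))) (domain E)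

    restrict-enrichedOn : EnrichedConvexOn n (segment F (2 ℕ.* n)) (restrict F)
    restrict-enrichedOn = record
      { domain         = segment-restrict-≤ F ℕ.≤-refl
      ; convexSegments = convex
      ; discreteLayers = λ t t<n → DiscreteLayerAt-transfer t<n (λ k≤ → sym (segment-restrict-≤ F k≤))
                                       (discreteLayers E t (ℕ.m<n⇒m<1+n t<n))
      }
      where
      convex : ∀ k → IsConvex (segment (restrict F) k)
      convex k with k ℕ.≤? 2 ℕ.* n
      ... | yes k≤ = subst IsConvex (sym (segment-restrict-≤ F k≤)) (convexSegments E k)
      ... | no  k≰ = subst IsConvex
                       (sym (trans (segment-≥ (restrict F) (ℕ.≰⇒≥ k≰)) (segment-restrict-≤ F ℕ.≤-refl)))
                       (convexSegments E (2 ℕ.* n))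

    topLayer : Layer (segment F (2 ℕ.* n)) (segment F (suc (2 ℕ.* n))) D
    topLayer = segment-⊆-suc F (2 ℕ.* n)
             , subst (segment F (suc (2 ℕ.* n)) ⊆_) segment-2+2n (segment-⊆-suc F (suc (2 ℕ.* n)))
             , convexSegments E (suc (2 ℕ.* n))
             , domain-convex E
             , DiscreteLayer-cong refl refl (trans (cong (segment F) (ℕ.+-comm _ 2)) segment-2+2n)
                 (discreteLayers E n (ℕ.n<1+n n))

    extend-topLayer-restrict : extend (segment F (suc (2 ℕ.* n))) D (restrict F) ≡ F
    extend-topLayer-restrict =
      trans (cong (λ X → extend _ X (restrict F)) (sym segment-2+2n)) (extend-restrict F)

  private
    infix 4 _≟_
    _≟_ : (A B : Subset m) → Dec (A ≡ B)
    _≟_ = Vec.≡-dec Bool._≟_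

  discrete? : ∀ (h : Subset m → Subset m) S → Dec (DiscreteOn h S)
  discrete? h S with All.all? (λ C → C ⊆? S →-dec (h C ∩ S) ≟ C) (subsets m)
  ... | yes all = yes λ C → All.lookup all (∈-subsets C)
  ... | no ¬all = no λ discrete → ¬all (All.tabulate λ {C} _ → discrete C)

  layer? : ∀ A B D → Dec (Layer A B D)
  layer? A B D = A ⊆? B ×-dec B ⊆? D ×-dec g B ≟ B ×-dec g D ≟ D ×-dec discrete? (minor g A D) (B ─ A)

  properLayer? : ∀ D → (AB : Subset m × Subset m) → Dec (proj₁ AB ⊂ D × Layer (proj₁ AB) (proj₂ AB) D)
  properLayer? D (A , B) = A ⊂? D ×-dec layer? A B D

  properLayers : Subset m → List (Subset m × Subset m)
  properLayers D = filter (properLayer? D) (cartesianProduct (subsets m) (subsets m))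

  -- (D , D) is the only layer (A , B) below D with A = D.
  layers : Subset m → List (Subset m × Subset m)
  layers D = (D , D) ∷ properLayers D

  extensions : ∀ {n} → (Subset m → List (Vec (Maybe ⟦ n ⟧) m)) → Subset m →
    Subset m × Subset m → List (Vec (Maybe ⟦ suc n ⟧) m)
  extensions E D (A , B) = List.map (extend B D) (E A)

  enrichedOn : ∀ n → Subset m → List (Vec (Maybe ⟦ n ⟧) m)
  enrichedOn zero    D = filter (λ _ → D ≟ ⊥) (replicate m nothing ∷ [])
  enrichedOn (suc n) D = concatMap (extensions (enrichedOn n) D) (layers D)

  ∈-properLayers⁻ : ∀ {A B D} → (A , B) ∈ properLayers D → A ⊂ D × Layer A B D
  ∈-properLayers⁻ {D = D} =
    proj₂ ∘ ∈-filter⁻ (properLayer? D) {xs = cartesianProduct (subsets m) (subsets m)}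

  ∈-layers⁻ : ∀ {A B D} → IsConvex A → (A , B) ∈ layers D → Layer A B D
  ∈-layers⁻ A-convex (here refl) = Layer-refl A-convex
  ∈-layers⁻ _        (there AB∈) = proj₂ (∈-properLayers⁻ AB∈)

  ∈-layers⁺ : ∀ {A B D} → Layer A B D → (A , B) ∈ layers D
  ∈-layers⁺ {A} {B} {D} layer@(A⊆B , B⊆D , _) with A ⊂? D
  ... | yes A⊂D = there (∈-filter⁺ (properLayer? D)
                    (∈-cartesianProduct⁺ (∈-subsets A) (∈-subsets B)) (A⊂D , layer))
  ... | no  A⊄D with refl ← ⊆∧⊄⇒≡ (λ x∈A → B⊆D (A⊆B x∈A)) A⊄D with refl ← ⊆-antisym B⊆D A⊆B = here refl

  layers-unique : ∀ D → Unique (layers D)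
  layers-unique D = All.tabulate D,D∉
                  ∷ Unique.filter⁺ _ (Unique.cartesianProduct⁺ (subsets-unique m) (subsets-unique m))
    where
    D,D∉ : ∀ {AB} → AB ∈ properLayers D → (D , D) ≢ AB
    D,D∉ AB∈ refl = ⊂-irref refl (proj₁ (∈-properLayers⁻ AB∈))

  enrichedOn-sound : ∀ n {D F} → F ∈ enrichedOn n D → EnrichedConvexOn n D F
  enrichedOn-sound zero {D} F∈ with ∈-filter⁻ (λ _ → D ≟ ⊥) F∈
  ... | here refl , refl = record
    { domain         = segment-nowhere m 0
    ; convexSegments = λ k → subst IsConvex (sym (segment-nowhere m k)) loopless
    ; discreteLayers = λ _ ()
    }
  enrichedOn-sound (suc n) {D} F∈ with find (∈-concatMap⁻ (extensions (enrichedOn n) D) F∈)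
  ... | (A , B) , AB∈ , F∈ext with ∈-map⁻ (extend B D) F∈ext
  ... | F′ , F′∈ , refl = extend-enrichedOn (∈-layers⁻ (domain-convex E′) AB∈) E′
    where E′ = enrichedOn-sound n F′∈

  enrichedOn-complete : ∀ n {D F} → EnrichedConvexOn n D F → F ∈ enrichedOn n D
  enrichedOn-complete zero {D} {F} E = ∈-filter⁺ (λ _ → D ≟ ⊥) (here (nowhere-unique F))
    (trans (sym (domain E)) (trans (cong (λ F → segment F 0) (nowhere-unique F)) (segment-nowhere m 0)))
  enrichedOn-complete (suc n) {D} {F} E =
    ∈-concatMap⁺ (extensions (enrichedOn n) D) (lose (∈-layers⁺ (topLayer E))
      (subst (_∈ extensions (enrichedOn n) D _) (extend-topLayer-restrict E)
        (∈-map⁺ (extend _ D) (enrichedOn-complete n (restrict-enrichedOn E)))))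

  extend-injective : ∀ {n} B D {F F′ : Vec (Maybe ⟦ n ⟧) m} → extend B D F ≡ extend B D F′ → F ≡ F′
  extend-injective B D {F} {F′} eq =
    trans (sym (restrict-extend B D F)) (trans (cong restrict eq) (restrict-extend B D F′))

  enrichedOn-unique : ∀ n D → Unique (enrichedOn n D)
  enrichedOn-unique zero    D = Unique.filter⁺ (λ _ → D ≟ ⊥) ([] ∷ [])
  enrichedOn-unique (suc n) D = concatMap-unique (extensions (enrichedOn n) D) topLayerOf (layers-unique D)
    (λ (A , B) → Unique.map⁺ (extend-injective B D) (enrichedOn-unique n A)) topLayerOf-extensions
    where
    topLayerOf : Vec (Maybe ⟦ suc n ⟧) m → Subset m × Subset m
    topLayerOf F = segment F (2 ℕ.* n) , segment F (suc (2 ℕ.* n))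
    topLayerOf-extensions : ∀ {AB F} → AB ∈ layers D → F ∈ extensions (enrichedOn n) D AB →
                            topLayerOf F ≡ AB
    topLayerOf-extensions {A , B} AB∈ F∈ with ∈-map⁻ (extend B D) F∈
    ... | F′ , F′∈ , refl =
      cong₂ _,_ (trans (segment-extend-≤ B D F′ ℕ.≤-refl) (domain E′))
                (segment-extend-bar≡ (proj₁ (∈-layers⁻ (domain-convex E′) AB∈)) (domain E′))
      where E′ = enrichedOn-sound n F′∈

  length-enrichedOn-suc : ∀ D n → length (enrichedOn (suc n) D) ≡
    length (enrichedOn n D) ℕ.+ sum (List.map (length ∘ extensions (enrichedOn n) D) (properLayers D))
  length-enrichedOn-suc D n = trans (length-concatMap (extensions (enrichedOn n) D) (layers D))
    (cong (ℕ._+ sum (List.map (length ∘ extensions (enrichedOn n) D) (properLayers D)))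
          (List.length-map (extend D D) (enrichedOn n D)))

  enrichedOn-newtonForm : ∀ D → HasNewtonForm (λ n → length (enrichedOn n D))
  enrichedOn-newtonForm = WF.All.wfRec ⊂-wellFounded _ _ step
    where
    step : ∀ D → WfRec _⊂_ (λ D → HasNewtonForm (λ n → length (enrichedOn n D))) D →
           HasNewtonForm (λ n → length (enrichedOn n D))
    step D IH = newtonForm-step
      (newtonForm-sum (properLayers D) (λ AB n → length (extensions (enrichedOn n) D AB)) block)
      (length-enrichedOn-suc D)
      where
      block : ∀ {AB} → AB ∈ properLayers D → HasNewtonForm (λ n → length (extensions (enrichedOn n) D AB))
      block {A , B} AB∈ = newtonForm-resp (λ n → sym (List.length-map (extend B D) (enrichedOn n A)))
                                          (IH (proj₁ (∈-properLayers⁻ AB∈)))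

  module _ {n} (f : Vec ⟦ n ⟧ m) where

    private
      Bar : Fin n → Set
      Bar i = DiscreteOn (minor g (preSeg f (2 ℕ.* toℕ i)) (preSeg f (2 ℕ.* toℕ i ℕ.+ 2))) (preBar f i)

      layer⇒bar : ∀ i → DiscreteLayerAt (Vec.map just f) (toℕ i) → Bar i
      layer⇒bar i L = subst (DiscreteOn _) (sym (preBar≡preSeg─preSeg f i))
        (DiscreteLayer-cong (segment-map-just f _) (segment-map-just f _) (segment-map-just f _) L)

      bar⇒layer : ∀ i → Bar i → DiscreteLayerAt (Vec.map just f) (toℕ i)
      bar⇒layer i B = DiscreteLayer-cong (sym (segment-map-just f _)) (sym (segment-map-just f _))
        (sym (segment-map-just f _)) (subst (DiscreteOn _) (preBar≡preSeg─preSeg f i) B)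

    enrichedConvex⇔enrichedOn : EnrichedConvex G f ⇔ EnrichedConvexOn n ⊤ (Vec.map just f)
    enrichedConvex⇔enrichedOn = mk⇔ to from
      where
      open EnrichedConvex
      to : EnrichedConvex G f → EnrichedConvexOn n ⊤ (Vec.map just f)
      to ec = record
        { domain         = segment-map-just-2n f
        ; convexSegments = λ k → subst IsConvex (sym (segment-map-just f k)) (convexPreimages ec k)
        ; discreteLayers = λ t t<n → subst (DiscreteLayerAt (Vec.map just f)) (Fin.toℕ-fromℕ< t<n)
                                       (bar⇒layer (fromℕ< t<n) (discreteBars ec (fromℕ< t<n)))
        }
      from : EnrichedConvexOn n ⊤ (Vec.map just f) → EnrichedConvex G f
      from E = record
        { convexPreimages = λ k → subst IsConvex (segment-map-just f k) (convexSegments E k)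
        ; discreteBars    = λ i → layer⇒bar i (discreteLayers E (toℕ i) (Fin.toℕ<n i))
        }

  enrichedConvexFunctions : ∀ n → List (Vec ⟦ n ⟧ m)
  enrichedConvexFunctions n = mapMaybe sequenceA (enrichedOn n ⊤)

  ∈-enrichedConvexFunctions : ∀ n f → (f ∈ enrichedConvexFunctions n) ⇔ EnrichedConvex G f
  ∈-enrichedConvexFunctions n f = mk⇔ to from
    where
    to : f ∈ enrichedConvexFunctions n → EnrichedConvex G f
    to f∈ with ∈-mapMaybe⁻ sequenceA (enrichedOn n ⊤) f∈
    ... | F , F∈ , seq≡ with refl ← sequenceA≡just F seq≡ =
      Equivalence.from (enrichedConvex⇔enrichedOn f) (enrichedOn-sound n F∈)
    from : EnrichedConvex G f → f ∈ enrichedConvexFunctions n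
    from ec = ∈-mapMaybe⁺ sequenceA
      (enrichedOn-complete n (Equivalence.to (enrichedConvex⇔enrichedOn f) ec)) (sequenceA-map-just f)

  enrichedConvexFunctions-unique : ∀ n → Unique (enrichedConvexFunctions n)
  enrichedConvexFunctions-unique n = mapMaybe-unique sequenceA
    (λ {F} {F′} e e′ → trans (sequenceA≡just F e) (sym (sequenceA≡just F′ e′))) (enrichedOn-unique n ⊤)

  length-enrichedConvexFunctions : ∀ n → length (enrichedConvexFunctions n) ≡ length (enrichedOn n ⊤)
  length-enrichedConvexFunctions n = length-mapMaybe-total sequenceA
    (All.tabulate λ F∈ → segment≡⊤⇒sequenceA-just _ (domain (enrichedOn-sound n F∈)))

mainTheorem6 : (m : ℕ) (G : ConvexGeometry m) →
    Σ (List ℚ) λ p → (n : ℕ) →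
      Σ ℕ λ c → NumberOfEnrichedConvex G n c × evalPoly p (ℕtoℚ n) ≡ ℕtoℚ c
mainTheorem6 m G = proj₁ polynomial , λ n →
  length (enrichedConvexFunctions n) ,
  (enrichedConvexFunctions n , enrichedConvexFunctions-unique n , ∈-enrichedConvexFunctions n , refl) ,
  proj₂ polynomial n
  where
  open Enumeration G
  polynomial : Σ (List ℚ) λ p → ∀ n → evalPoly p (ℕtoℚ n) ≡ ℕtoℚ (length (enrichedConvexFunctions n))
  polynomial = newtonForm⇒polynomial
    (newtonForm-resp (sym ∘ length-enrichedConvexFunctions) (enrichedOn-newtonForm ⊤))
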